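{- Let $M$ be an autonomous stochastic multi-agent system (as described in the context) and $A$ an agent of $M$. For every finite path $\rho$ of $M$ for which $be_A(\rho)$ is defined, the belief $be_A(\rho)$ can be computed recursively over the length of $\rho$ as follows: (i) for a path consisting of a single initial state $s$, $$be_A(s)=\frac{\mu_0(s)}{\sum_{s'\in S,\ obs_A(s')=obs_A(s)}\mu_0(s')};$$ (ii) for a path $\rho$ with $|\rho|=k+2$, $k\ge 0$, $$be_A(\rho)=\frac{be_A(\rho[0..k])\cdot T_A(\rho(k),\rho(k+1))}{\sum_{\rho'\in FPath,\ obs_A(\rho')=obs_A(\rho[0..k])}\ \sum_{s\in S,\ obs_A(s)=obs_A(\rho(k+1))} be_A(\rho')\cdot T_A(\rho'(k),s)}.$$
   Context: An autonomous stochastic multi-agent system $M$ has: a finite set of agents $Ags$; a finite set of states $S$ with an initial distribution $\mu_0$ on $S$; for each agent $A$ a finite set of observations $Obs_A$ and an observation function $obs_A:S\to Obs_A$, extended to finite sequences of states pointwise ($obs_A(s_0\dots s_n)=obs_A(s_0)\dots obs_A(s_n)$); a set of transitions between states, each of a type (temporal, or a goal/intention change of some agent $B$); and, for each agent $A$, an auxiliary weight function $T_A:S\times S\to[0,1]$ (for a temporal step it is the temporal transition probability, for a goal or intention change of another agent $B\neq A$ it is $A$'s preference probability for that change, and for a goal or intention change of $A$ itself it is $1$; it is $0$ for pairs that are not transitions). A finite path is a sequence $\rho=s_0s_1\dots s_n$ of states with each consecutive pair a transition; $FPath$ is the set of finite paths, $|\rho|$ is the number of states, $\rho(k)$ is the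 $(k+1)$-th state and $\rho[0..k]=s_0\dots s_k$. It is assumed that paths with equal $obs_A$-observation sequences have the same sequence of transition types. Define $\Pr_A(\rho)=\mu_0(s_0)\prod_{k=0}^{n-1}T_A(s_k,s_{k+1})$ (the probability of the basic cylinder of $\rho$ in agent $A$'s probability space). The belief of $A$ is the conditional probability $be_A(\rho)=\Pr_A(\rho)\big/\sum_{\rho'\in FPath,\ obs_A(\rho')=obs_A(\rho)}\Pr_A(\rho')$, defined when the denominator is positive.
   Formalization: The initial distribution $\mu_0$, the weight functions $T_A$, and the temporal and preference probabilities take rational values, so $\Pr_A$ and the beliefs $be_A$ are rational as well. -}

module Defs where

open import Data.Nat using (ℕ; zero; suc)
open import Data.Fin using (Fin; zero; suc)
import Data.Fin as Fin
open import Data.Bool using (Bool; true; false; _∧_; if_then_else_)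
open import Data.Maybe using (Maybe; just; nothing)
open import Data.List using (List; []; _∷_; concatMap; map)
open import Data.Vec using (Vec; []; _∷_; head; last; init)
open import Data.Rational using (ℚ; 0ℚ; 1ℚ; _+_; _*_; _≤_; _÷_; ≢-nonZero)
import Data.Rational.Properties as ℚP
open import Relation.Nullary using (yes; no; does)
open import Relation.Binary.PropositionalEquality using (_≡_; _≢_)

-- Total division on ℚ: p ÷ₜ q = p / q when q ≠ 0, and 0 otherwise.
-- (Only ever used where the denominator is provably positive.)
_÷ₜ_ : ℚ → ℚ → ℚ
p ÷ₜ q with q ℚP.≟ 0ℚ
... | yes _  = 0ℚ
... | no q≢0 = _÷_ p q {{≢-nonZero q≢0}}

ΣFin : (n : ℕ) → (Fin n → ℚ) → ℚ
ΣFin zero    f = 0ℚ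
ΣFin (suc n) f = f zero + ΣFin n (λ i → f (suc i))

ΣList : {X : Set} → List X → (X → ℚ) → ℚ
ΣList []       f = 0ℚ
ΣList (x ∷ xs) f = f x + ΣList xs f

allFinL : (n : ℕ) → List (Fin n)
allFinL zero    = []
allFinL (suc n) = zero ∷ map suc (allFinL n)

allVecs : (n L : ℕ) → List (Vec (Fin n) L)
allVecs n zero    = [] ∷ []
allVecs n (suc L) = concatMap (λ v → map (_∷ v) (allFinL n)) (allVecs n L)

_==_ : {m : ℕ} → Fin m → Fin m → Bool
i == j = does (i Fin.≟ j)

data TType (nA : ℕ) : Set where
  temporal        : TType nA
  goalChange      : Fin nA → TType nA
  intentionChange : Fin nA → TType nA


isJust : {X : Set} → Maybe X → Bool
isJust (just _) = true
isJust nothing  = false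

IsPathAux : {nS : ℕ} {X : Set} → (Fin nS → Fin nS → Maybe X) → {k : ℕ} → Vec (Fin nS) (suc k) → Bool
IsPathAux tr (s ∷ [])         = true
IsPathAux tr (s ∷ (t ∷ ρ))    = isJust (tr s t) ∧ IsPathAux tr (t ∷ ρ)

TypesAux : {nS : ℕ} {X : Set} → (Fin nS → Fin nS → Maybe X) → {k : ℕ} → Vec (Fin nS) (suc k) → List (Maybe X)
TypesAux tr (s ∷ [])      = []
TypesAux tr (s ∷ (t ∷ ρ)) = tr s t ∷ TypesAux tr (t ∷ ρ)

ObsEqAux : {nS m : ℕ} → (Fin nS → Fin m) → {L : ℕ} → Vec (Fin nS) L → Vec (Fin nS) L → Bool
ObsEqAux o []       []         = true
ObsEqAux o (s ∷ ρ)  (s' ∷ ρ')  = (o s == o s') ∧ ObsEqAux o ρ ρ'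

-- An autonomous stochastic multi-agent system.
-- Agents are Fin nAg, states Fin nS; trans s t = just τ iff (s,t) is a transition of type τ.
record ASMAS : Set where
  field
    nAg    : ℕ
    nS     : ℕ
    μ₀     : Fin nS → ℚ
    nObs   : Fin nAg → ℕ
    obs    : (A : Fin nAg) → Fin nS → Fin (nObs A)
    trans  : Fin nS → Fin nS → Maybe (TType nAg)
    Ptemp  : Fin nS → Fin nS → ℚ
    pref   : (A : Fin nAg) → Fin nS → Fin nS → ℚ
    T      : (A : Fin nAg) → Fin nS → Fin nS → ℚ
    μ₀-nonneg : ∀ s → 0ℚ ≤ μ₀ s
    μ₀-sum    : ΣFin nS μ₀ ≡ 1ℚ
    T-nonneg  : ∀ A s t → 0ℚ ≤ T A s t
    T-le1     : ∀ A s t → T A s t ≤ 1ℚ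
    T-none    : ∀ A s t → trans s t ≡ nothing → T A s t ≡ 0ℚ
    T-temp    : ∀ A s t → trans s t ≡ just temporal → T A s t ≡ Ptemp s t
    T-goalSelf : ∀ A s t → trans s t ≡ just (goalChange A) → T A s t ≡ 1ℚ
    T-intSelf  : ∀ A s t → trans s t ≡ just (intentionChange A) → T A s t ≡ 1ℚ
    T-goalOther : ∀ A B s t → A ≢ B → trans s t ≡ just (goalChange B) → T A s t ≡ pref A s t
    T-intOther  : ∀ A B s t → A ≢ B → trans s t ≡ just (intentionChange B) → T A s t ≡ pref A s t
    obs-types : ∀ A {k} (ρ ρ' : Vec (Fin nS) (suc k)) →
                IsPathAux trans ρ ≡ true → IsPathAux trans ρ' ≡ true →
                ObsEqAux (obs A) ρ ρ' ≡ true → TypesAux trans ρ ≡ TypesAux trans ρ'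

module _ (M : ASMAS) where
  open ASMAS M

  S : Set
  S = Fin nS

  -- Finite paths with k+1 states are the vectors ρ : Vec S (suc k) with isPath ρ ≡ true.
  isPath : {k : ℕ} → Vec S (suc k) → Bool
  isPath = IsPathAux trans

  obsEq : (A : Fin nAg) → {L : ℕ} → Vec S L → Vec S L → Bool
  obsEq A = ObsEqAux (obs A)

  prodT : (A : Fin nAg) → {k : ℕ} → Vec S (suc k) → ℚ
  prodT A (s ∷ [])      = 1ℚ
  prodT A (s ∷ (t ∷ ρ)) = T A s t * prodT A (t ∷ ρ)

  PrA : (A : Fin nAg) → {k : ℕ} → Vec S (suc k) → ℚ
  PrA A ρ = μ₀ (head ρ) * prodT A ρ

  -- Σ_{ρ' ∈ FPath, |ρ'| = |ρ|, obs_A(ρ') = obs_A(ρ)} f(ρ')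
  -- (paths with equal observation sequences necessarily have equal length)
  ΣobsEq : (A : Fin nAg) → {k : ℕ} → Vec S (suc k) → (Vec S (suc k) → ℚ) → ℚ
  ΣobsEq A {k} ρ f = ΣList (allVecs nS (suc k))
                       (λ ρ' → if isPath ρ' ∧ obsEq A ρ' ρ then f ρ' else 0ℚ)

  denA : (A : Fin nAg) → {k : ℕ} → Vec S (suc k) → ℚ
  denA A ρ = ΣobsEq A ρ (PrA A)

  -- be_A(ρ) = Pr_A(ρ) / Σ_{ρ' obs-equivalent} Pr_A(ρ')   (meaningful when denA A ρ > 0)
  be : (A : Fin nAg) → {k : ℕ} → Vec S (suc k) → ℚ
  be A ρ = PrA A ρ ÷ₜ denA A ρ

{-# OPTIONS --safe #-}

-- Since T_A vanishes on non-transitions, the denominator of be_A(ρ t) is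
-- Σ_{ρ' ~ ρ} Pr_A(ρ') · Σ_{s ~ t} T_A(last ρ', s), where ~ is equality of observations.
-- All ρ' ~ ρ share the denominator D of be_A(ρ), so Pr_A(ρ') = be_A(ρ') · D, and D
-- cancels from numerator and denominator. D ≠ 0 since the new denominator is at most
-- |S| · D.
module Submission where

open import Defs
open import Data.Nat using (ℕ; zero; suc)
open import Data.Fin using (Fin)
import Data.Fin as Fin
open import Data.Bool using (Bool; true; false; _∧_; if_then_else_)
open import Data.Bool.Properties using (∧-assoc; ∧-identityʳ; ∧-conicalʳ)
open import Data.Maybe using (Maybe; just; nothing)
open import Data.List using (List; []; _∷_; _++_; map; concatMap)
open import Data.Vec using (Vec; []; _∷_; _∷ʳ_; last; init; initLast)
open import Data.Product using (_×_; _,_)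
open import Data.Rational using (ℚ; 0ℚ; 1ℚ; _+_; _*_; _≤_; _<_; 1/_; ≢-nonZero; nonNegative)
import Data.Rational.Properties as ℚP
open import Algebra.Bundles using (CommutativeMonoid)
import Algebra.Properties.CommutativeSemigroup as CommSemigroupProperties
open import Relation.Nullary using (Dec; yes; no; contradiction)
open import Relation.Binary.PropositionalEquality
  using (_≡_; _≢_; refl; sym; trans; cong; cong₂; module ≡-Reasoning)

private
  module +-Properties =
    CommSemigroupProperties (CommutativeMonoid.commutativeSemigroup ℚP.+-0-commutativeMonoid)
  module *-Properties =
    CommSemigroupProperties (CommutativeMonoid.commutativeSemigroup ℚP.*-1-commutativeMonoid)

p÷ₜq*q≡p : ∀ p {q} → q ≢ 0ℚ → (p ÷ₜ q) * q ≡ p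
p÷ₜq*q≡p p {q} q≢0 with q ℚP.≟ 0ℚ
... | yes q≡0 = contradiction q≡0 q≢0
... | no q≢0′ = let instance _ = ≢-nonZero q≢0′ in begin
  p * 1/ q * q   ≡⟨ ℚP.*-assoc p (1/ q) q ⟩
  p * (1/ q * q) ≡⟨ cong (p *_) (ℚP.*-inverseˡ q) ⟩
  p * 1ℚ         ≡⟨ ℚP.*-identityʳ p ⟩
  p              ∎
  where open ≡-Reasoning

÷ₜ-unique : ∀ {p q r} → q ≢ 0ℚ → r * q ≡ p → p ÷ₜ q ≡ r
÷ₜ-unique {p} {q} {r} q≢0 r*q≡p with q ℚP.≟ 0ℚ
... | yes q≡0 = contradiction q≡0 q≢0
... | no q≢0′ = let instance _ = ≢-nonZero q≢0′ in begin
  p * 1/ q       ≡⟨ cong (_* 1/ q) (sym r*q≡p) ⟩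
  r * q * 1/ q   ≡⟨ ℚP.*-assoc r q (1/ q) ⟩
  r * (q * 1/ q) ≡⟨ cong (r *_) (ℚP.*-inverseʳ q) ⟩
  r * 1ℚ         ≡⟨ ℚP.*-identityʳ r ⟩
  r              ∎
  where open ≡-Reasoning

*-≢0 : ∀ {p q} → p ≢ 0ℚ → q ≢ 0ℚ → p * q ≢ 0ℚ
*-≢0 {p} {q} p≢0 q≢0 p*q≡0 = p≢0 (begin
  p            ≡⟨ sym (÷ₜ-unique q≢0 refl) ⟩
  (p * q) ÷ₜ q ≡⟨ cong (_÷ₜ q) p*q≡0 ⟩
  0ℚ ÷ₜ q      ≡⟨ ÷ₜ-unique q≢0 (ℚP.*-zeroˡ q) ⟩
  0ℚ           ∎)
  where open ≡-Reasoning

÷ₜ-cancelʳ : ∀ p r {q} → q ≢ 0ℚ → (p * q) ÷ₜ (r * q) ≡ p ÷ₜ r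
÷ₜ-cancelʳ p r {q} q≢0 = by-cases (r ℚP.≟ 0ℚ)
  where
  open ≡-Reasoning
  by-cases : Dec (r ≡ 0ℚ) → (p * q) ÷ₜ (r * q) ≡ p ÷ₜ r
  by-cases (yes refl) = cong ((p * q) ÷ₜ_) (ℚP.*-zeroˡ q)
  by-cases (no r≢0)   = ÷ₜ-unique (*-≢0 r≢0 q≢0) (begin
    (p ÷ₜ r) * (r * q) ≡⟨ sym (ℚP.*-assoc (p ÷ₜ r) r q) ⟩
    (p ÷ₜ r) * r * q   ≡⟨ cong (_* q) (p÷ₜq*q≡p p r≢0) ⟩
    p * q              ∎)

*-nonNeg : ∀ {p q} → 0ℚ ≤ p → 0ℚ ≤ q → 0ℚ ≤ p * q
*-nonNeg {p} {q} 0≤p 0≤q = ℚP.≤-trans (ℚP.≤-reflexive (sym (ℚP.*-zeroˡ q)))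
                                      (ℚP.*-monoʳ-≤-nonNeg q {{nonNegative 0≤q}} 0≤p)

module _ {X : Set} where

  ΣList-cong : ∀ (xs : List X) {f g : X → ℚ} → (∀ x → f x ≡ g x) → ΣList xs f ≡ ΣList xs g
  ΣList-cong []       f≗g = refl
  ΣList-cong (x ∷ xs) f≗g = cong₂ _+_ (f≗g x) (ΣList-cong xs f≗g)

  ΣList-++ : ∀ (xs ys : List X) f → ΣList (xs ++ ys) f ≡ ΣList xs f + ΣList ys f
  ΣList-++ []       ys f = sym (ℚP.+-identityˡ _)
  ΣList-++ (x ∷ xs) ys f =
    trans (cong (f x +_) (ΣList-++ xs ys f)) (sym (ℚP.+-assoc (f x) _ _))

  ΣList-*ʳ : ∀ (xs : List X) f c → ΣList xs (λ x → f x * c) ≡ ΣList xs f * c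
  ΣList-*ʳ []       f c = sym (ℚP.*-zeroˡ c)
  ΣList-*ʳ (x ∷ xs) f c =
    trans (cong (f x * c +_) (ΣList-*ʳ xs f c)) (sym (ℚP.*-distribʳ-+ c (f x) _))

  ΣList-mono-≤ : ∀ (xs : List X) {f g : X → ℚ} → (∀ x → f x ≤ g x) → ΣList xs f ≤ ΣList xs g
  ΣList-mono-≤ []       f≤g = ℚP.≤-refl
  ΣList-mono-≤ (x ∷ xs) f≤g = ℚP.+-mono-≤ (f≤g x) (ΣList-mono-≤ xs f≤g)

module _ {X Y : Set} where

  ΣList-map : ∀ (h : X → Y) xs f → ΣList (map h xs) f ≡ ΣList xs (λ x → f (h x))
  ΣList-map h []       f = refl
  ΣList-map h (x ∷ xs) f = cong (f (h x) +_) (ΣList-map h xs f)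

  ΣList-concatMap : ∀ (g : X → List Y) xs f →
                    ΣList (concatMap g xs) f ≡ ΣList xs (λ x → ΣList (g x) f)
  ΣList-concatMap g []       f = refl
  ΣList-concatMap g (x ∷ xs) f =
    trans (ΣList-++ (g x) (concatMap g xs) f) (cong (ΣList (g x) f +_) (ΣList-concatMap g xs f))

ΣFin-cong : ∀ n {f g : Fin n → ℚ} → (∀ i → f i ≡ g i) → ΣFin n f ≡ ΣFin n g
ΣFin-cong zero    f≗g = refl
ΣFin-cong (suc n) f≗g = cong₂ _+_ (f≗g Fin.zero) (ΣFin-cong n (λ i → f≗g (Fin.suc i)))

ΣFin-zero : ∀ n → ΣFin n (λ _ → 0ℚ) ≡ 0ℚ
ΣFin-zero zero    = refl
ΣFin-zero (suc n) = trans (ℚP.+-identityˡ _) (ΣFin-zero n)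

ΣFin-+ : ∀ n (f g : Fin n → ℚ) → ΣFin n (λ i → f i + g i) ≡ ΣFin n f + ΣFin n g
ΣFin-+ zero    f g = sym (ℚP.+-identityˡ 0ℚ)
ΣFin-+ (suc n) f g = trans (cong (f Fin.zero + g Fin.zero +_) (ΣFin-+ n _ _))
                           (+-Properties.interchange (f Fin.zero) (g Fin.zero) _ _)

ΣFin-comm : ∀ m n (f : Fin m → Fin n → ℚ) →
            ΣFin m (λ i → ΣFin n (f i)) ≡ ΣFin n (λ j → ΣFin m (λ i → f i j))
ΣFin-comm zero    n f = sym (ΣFin-zero n)
ΣFin-comm (suc m) n f = trans (cong (ΣFin n (f Fin.zero) +_) (ΣFin-comm m n _))
                              (sym (ΣFin-+ n (f Fin.zero) _))

ΣFin-*ˡ : ∀ n c (f : Fin n → ℚ) → ΣFin n (λ i → c * f i) ≡ c * ΣFin n f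
ΣFin-*ˡ zero    c f = sym (ℚP.*-zeroʳ c)
ΣFin-*ˡ (suc n) c f = trans (cong (c * f Fin.zero +_) (ΣFin-*ˡ n c _))
                            (sym (ℚP.*-distribˡ-+ c (f Fin.zero) _))

ΣFin-mono-≤ : ∀ n {f g : Fin n → ℚ} → (∀ i → f i ≤ g i) → ΣFin n f ≤ ΣFin n g
ΣFin-mono-≤ zero    f≤g = ℚP.≤-refl
ΣFin-mono-≤ (suc n) f≤g = ℚP.+-mono-≤ (f≤g Fin.zero) (ΣFin-mono-≤ n (λ i → f≤g (Fin.suc i)))

ΣFin-if-*ˡ : ∀ n (c : Fin n → Bool) x (f : Fin n → ℚ) →
             ΣFin n (λ i → if c i then x * f i else 0ℚ) ≡ x * ΣFin n (λ i → if c i then f i else 0ℚ)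
ΣFin-if-*ˡ n c x f = trans (ΣFin-cong n pull-out) (ΣFin-*ˡ n x _)
  where
  pull-out : ∀ i → (if c i then x * f i else 0ℚ) ≡ x * (if c i then f i else 0ℚ)
  pull-out i with c i
  ... | true  = refl
  ... | false = sym (ℚP.*-zeroʳ x)

ΣList-allFinL : ∀ n (f : Fin n → ℚ) → ΣList (allFinL n) f ≡ ΣFin n f
ΣList-allFinL zero    f = refl
ΣList-allFinL (suc n) f =
  cong (f Fin.zero +_) (trans (ΣList-map Fin.suc (allFinL n) f) (ΣList-allFinL n _))

module _ (n : ℕ) where

  ΣList-allVecs-∷ : ∀ L (f : Vec (Fin n) (suc L) → ℚ) →
    ΣList (allVecs n (suc L)) f ≡ ΣList (allVecs n L) (λ v → ΣFin n (λ s → f (s ∷ v)))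
  ΣList-allVecs-∷ L f = trans (ΣList-concatMap _ (allVecs n L) f) (ΣList-cong (allVecs n L) λ v →
    trans (ΣList-map (_∷ v) (allFinL n) f) (ΣList-allFinL n _))

  ΣList-allVecs-∷ʳ : ∀ L (f : Vec (Fin n) (suc L) → ℚ) →
    ΣList (allVecs n (suc L)) f ≡ ΣList (allVecs n L) (λ w → ΣFin n (λ s → f (w ∷ʳ s)))
  ΣList-allVecs-∷ʳ zero    f = ΣList-allVecs-∷ zero f
  ΣList-allVecs-∷ʳ (suc L) f = begin
    ΣList (allVecs n (suc (suc L))) f
      ≡⟨ ΣList-allVecs-∷ (suc L) f ⟩
    ΣList (allVecs n (suc L)) (λ v → ΣFin n (λ s → f (s ∷ v)))
      ≡⟨ ΣList-allVecs-∷ʳ L _ ⟩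
    ΣList (allVecs n L) (λ w → ΣFin n (λ s′ → ΣFin n (λ s → f (s ∷ (w ∷ʳ s′)))))
      ≡⟨ ΣList-cong (allVecs n L) (λ w → ΣFin-comm n n _) ⟩
    ΣList (allVecs n L) (λ w → ΣFin n (λ s → ΣFin n (λ s′ → f ((s ∷ w) ∷ʳ s′))))
      ≡⟨ sym (ΣList-allVecs-∷ L _) ⟩
    ΣList (allVecs n (suc L)) (λ w → ΣFin n (λ s → f (w ∷ʳ s))) ∎
    where open ≡-Reasoning

module _ {nS : ℕ} {X : Set} (tr : Fin nS → Fin nS → Maybe X) where

  IsPathAux-∷ʳ : ∀ {k} (w : Vec (Fin nS) (suc k)) s →
                 IsPathAux tr (w ∷ʳ s) ≡ IsPathAux tr w ∧ isJust (tr (last w) s)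
  IsPathAux-∷ʳ (a ∷ [])    s = ∧-identityʳ _
  IsPathAux-∷ʳ (a ∷ b ∷ w) s =
    trans (cong (isJust (tr a b) ∧_) (IsPathAux-∷ʳ (b ∷ w) s)) (sym (∧-assoc (isJust (tr a b)) _ _))

module _ {nS m : ℕ} (o : Fin nS → Fin m) where

  ObsEqAux-∷ʳ : ∀ {L} (w v : Vec (Fin nS) L) s t →
                ObsEqAux o (w ∷ʳ s) (v ∷ʳ t) ≡ ObsEqAux o w v ∧ (o s == o t)
  ObsEqAux-∷ʳ []      []      s t = ∧-identityʳ _
  ObsEqAux-∷ʳ (a ∷ w) (b ∷ v) s t =
    trans (cong ((o a == o b) ∧_) (ObsEqAux-∷ʳ w v s t)) (sym (∧-assoc (o a == o b) _ _))

  ObsEqAux-respʳ : ∀ {L} (u w v : Vec (Fin nS) L) →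
                   ObsEqAux o w v ≡ true → ObsEqAux o u w ≡ ObsEqAux o u v
  ObsEqAux-respʳ []      []      []      _ = refl
  ObsEqAux-respʳ (a ∷ u) (b ∷ w) (c ∷ v) w≈v with o b Fin.≟ o c
  ... | yes ob≡oc = cong₂ _∧_ (cong (o a ==_) ob≡oc) (ObsEqAux-respʳ u w v w≈v)
  ObsEqAux-respʳ (a ∷ u) (b ∷ w) (c ∷ v) () | no _

if-∧-factorise : ∀ a j b c (x y : ℚ) → (j ≡ false → y ≡ 0ℚ) →
  (if (a ∧ j) ∧ (b ∧ c) then x * y else 0ℚ) ≡ (if a ∧ b then x else 0ℚ) * (if c then y else 0ℚ)
if-∧-factorise false j     b     c     x y _   = sym (ℚP.*-zeroˡ (if c then y else 0ℚ))
if-∧-factorise true  true  false c     x y _   = sym (ℚP.*-zeroˡ (if c then y else 0ℚ))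
if-∧-factorise true  false false c     x y _   = sym (ℚP.*-zeroˡ (if c then y else 0ℚ))
if-∧-factorise true  true  true  true  x y _   = refl
if-∧-factorise true  true  true  false x y _   = sym (ℚP.*-zeroʳ x)
if-∧-factorise true  false true  false x y _   = sym (ℚP.*-zeroʳ x)
if-∧-factorise true  false true  true  x y y≡0 = sym (trans (cong (x *_) (y≡0 refl)) (ℚP.*-zeroʳ x))

module _ (M : ASMAS) (A : Fin (ASMAS.nAg M)) where
  open ASMAS M using (nS; μ₀; obs; T; T-none; T-nonneg; T-le1; μ₀-nonneg)
    renaming (trans to transition)

  private
    o : S M → Fin (ASMAS.nObs M A)
    o = obs A

  T-off-transition : ∀ s t → isJust (transition s t) ≡ false → T A s t ≡ 0ℚ
  T-off-transition s t _ with transition s t in eq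
  ... | nothing = T-none A s t eq
  T-off-transition s t () | just _

  prodT-∷ʳ : ∀ {k} (w : Vec (S M) (suc k)) s → prodT M A (w ∷ʳ s) ≡ prodT M A w * T A (last w) s
  prodT-∷ʳ (a ∷ [])    s = trans (ℚP.*-identityʳ (T A a s)) (sym (ℚP.*-identityˡ (T A a s)))
  prodT-∷ʳ (a ∷ b ∷ w) s =
    trans (cong (T A a b *_) (prodT-∷ʳ (b ∷ w) s)) (sym (ℚP.*-assoc (T A a b) _ _))

  PrA-∷ʳ : ∀ {k} (w : Vec (S M) (suc k)) s → PrA M A (w ∷ʳ s) ≡ PrA M A w * T A (last w) s
  PrA-∷ʳ (a ∷ w) s = trans (cong (μ₀ a *_) (prodT-∷ʳ (a ∷ w) s)) (sym (ℚP.*-assoc (μ₀ a) _ _))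

  prodT-nonNeg : ∀ {k} (w : Vec (S M) (suc k)) → 0ℚ ≤ prodT M A w
  prodT-nonNeg (a ∷ [])    = ℚP.nonNegative⁻¹ 1ℚ
  prodT-nonNeg (a ∷ b ∷ w) = *-nonNeg (T-nonneg A a b) (prodT-nonNeg (b ∷ w))

  PrA-nonNeg : ∀ {k} (w : Vec (S M) (suc k)) → 0ℚ ≤ PrA M A w
  PrA-nonNeg (a ∷ w) = *-nonNeg (μ₀-nonneg a) (prodT-nonNeg (a ∷ w))

  denA-respects-obsEq : ∀ {k} (w v : Vec (S M) (suc k)) → obsEq M A w v ≡ true → denA M A w ≡ denA M A v
  denA-respects-obsEq w v w≈v = ΣList-cong (allVecs nS _) λ u →
    cong (λ b → if isPath M u ∧ b then PrA M A u else 0ℚ) (ObsEqAux-respʳ o u w v w≈v)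

  be-*-denA : ∀ {k} (w : Vec (S M) (suc k)) → denA M A w ≢ 0ℚ → be M A w * denA M A w ≡ PrA M A w
  be-*-denA w = p÷ₜq*q≡p (PrA M A w)

  be-singleton : ∀ s → be M A (s ∷ []) ≡ μ₀ s ÷ₜ ΣFin nS (λ s′ → if o s′ == o s then μ₀ s′ else 0ℚ)
  be-singleton s = cong₂ _÷ₜ_ (ℚP.*-identityʳ (μ₀ s)) (begin
    denA M A (s ∷ [])
      ≡⟨ ΣList-allVecs-∷ʳ nS zero _ ⟩
    ΣFin nS (λ s′ → if true ∧ ((o s′ == o s) ∧ true) then μ₀ s′ * 1ℚ else 0ℚ) + 0ℚ
      ≡⟨ ℚP.+-identityʳ _ ⟩
    ΣFin nS (λ s′ → if true ∧ ((o s′ == o s) ∧ true) then μ₀ s′ * 1ℚ else 0ℚ)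
      ≡⟨ ΣFin-cong nS guard-simplifies ⟩
    ΣFin nS (λ s′ → if o s′ == o s then μ₀ s′ else 0ℚ) ∎)
    where
    open ≡-Reasoning
    guard-simplifies : ∀ s′ → (if true ∧ ((o s′ == o s) ∧ true) then μ₀ s′ * 1ℚ else 0ℚ)
                             ≡ (if o s′ == o s then μ₀ s′ else 0ℚ)
    guard-simplifies s′ with o s′ == o s
    ... | true  = ℚP.*-identityʳ (μ₀ s′)
    ... | false = refl

  module _ {k : ℕ} (ρ : Vec (S M) (suc k)) (t : S M) where

    classWeight : Vec (S M) (suc k) → ℚ
    classWeight w = if isPath M w ∧ obsEq M A w ρ then PrA M A w else 0ℚ

    stepMass : Vec (S M) (suc k) → ℚ
    stepMass w = ΣFin nS (λ s → if o s == o t then T A (last w) s else 0ℚ)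

    normaliser : ℚ
    normaliser = ΣobsEq M A ρ (λ ρ′ →
      ΣFin nS (λ s → if o s == o t then be M A ρ′ * T A (last ρ′) s else 0ℚ))

    denA-∷ʳ : denA M A (ρ ∷ʳ t) ≡ ΣList (allVecs nS (suc k)) (λ w → classWeight w * stepMass w)
    denA-∷ʳ = trans (ΣList-allVecs-∷ʳ nS (suc k) _) (ΣList-cong (allVecs nS (suc k)) λ w →
      trans (ΣFin-cong nS (extension w)) (ΣFin-*ˡ nS (classWeight w) _))
      where
      extension : ∀ w s →
        (if isPath M (w ∷ʳ s) ∧ obsEq M A (w ∷ʳ s) (ρ ∷ʳ t) then PrA M A (w ∷ʳ s) else 0ℚ)
        ≡ classWeight w * (if o s == o t then T A (last w) s else 0ℚ)
      extension w s
        rewrite IsPathAux-∷ʳ transition w s | ObsEqAux-∷ʳ o w ρ s t | PrA-∷ʳ w s =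
        if-∧-factorise (isPath M w) (isJust (transition (last w) s)) (obsEq M A w ρ) (o s == o t)
          (PrA M A w) (T A (last w) s) (T-off-transition (last w) s)

    denA-∷ʳ-≤ : denA M A (ρ ∷ʳ t) ≤ denA M A ρ * ΣFin nS (λ _ → 1ℚ)
    denA-∷ʳ-≤ = begin
      denA M A (ρ ∷ʳ t)
        ≡⟨ denA-∷ʳ ⟩
      ΣList (allVecs nS (suc k)) (λ w → classWeight w * stepMass w)
        ≤⟨ ΣList-mono-≤ (allVecs nS (suc k)) (λ w →
             ℚP.*-monoˡ-≤-nonNeg (classWeight w) {{nonNegative (classWeight-nonNeg w)}}
               (ΣFin-mono-≤ nS (guarded-T-≤-1 w))) ⟩
      ΣList (allVecs nS (suc k)) (λ w → classWeight w * ΣFin nS (λ _ → 1ℚ))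
        ≡⟨ ΣList-*ʳ (allVecs nS (suc k)) classWeight _ ⟩
      denA M A ρ * ΣFin nS (λ _ → 1ℚ) ∎
      where
      open ℚP.≤-Reasoning
      classWeight-nonNeg : ∀ w → 0ℚ ≤ classWeight w
      classWeight-nonNeg w with isPath M w ∧ obsEq M A w ρ
      ... | true  = PrA-nonNeg w
      ... | false = ℚP.≤-refl
      guarded-T-≤-1 : ∀ w s → (if o s == o t then T A (last w) s else 0ℚ) ≤ 1ℚ
      guarded-T-≤-1 w s with o s == o t
      ... | true  = T-le1 A (last w) s
      ... | false = ℚP.nonNegative⁻¹ 1ℚ

    denA-≢0 : 0ℚ < denA M A (ρ ∷ʳ t) → denA M A ρ ≢ 0ℚ
    denA-≢0 0<E D≡0 = ℚP.<-irrefl refl (ℚP.<-≤-trans 0<E (begin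
      denA M A (ρ ∷ʳ t)               ≤⟨ denA-∷ʳ-≤ ⟩
      denA M A ρ * ΣFin nS (λ _ → 1ℚ) ≡⟨ cong (_* ΣFin nS (λ _ → 1ℚ)) D≡0 ⟩
      0ℚ * ΣFin nS (λ _ → 1ℚ)         ≡⟨ ℚP.*-zeroˡ (ΣFin nS (λ _ → 1ℚ)) ⟩
      0ℚ                              ∎))
      where open ℚP.≤-Reasoning

    normaliser-*-denA : denA M A ρ ≢ 0ℚ → normaliser * denA M A ρ ≡ denA M A (ρ ∷ʳ t)
    normaliser-*-denA D≢0 =
      trans (sym (ΣList-*ʳ (allVecs nS (suc k)) _ D))
            (trans (ΣList-cong (allVecs nS (suc k)) summand) (sym denA-∷ʳ))
      where
      open ≡-Reasoning
      D : ℚ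
      D = denA M A ρ
      summand : ∀ w →
        (if isPath M w ∧ obsEq M A w ρ
         then ΣFin nS (λ s → if o s == o t then be M A w * T A (last w) s else 0ℚ)
         else 0ℚ) * D
        ≡ classWeight w * stepMass w
      summand w with isPath M w ∧ obsEq M A w ρ in inClass
      ... | false = trans (ℚP.*-zeroˡ D) (sym (ℚP.*-zeroˡ (stepMass w)))
      ... | true  = begin
        ΣFin nS (λ s → if o s == o t then be M A w * T A (last w) s else 0ℚ) * D
          ≡⟨ cong (_* D) (ΣFin-if-*ˡ nS (λ s → o s == o t) (be M A w) (T A (last w))) ⟩
        be M A w * stepMass w * D
          ≡⟨ *-Properties.xy∙z≈xz∙y (be M A w) (stepMass w) D ⟩
        be M A w * D * stepMass w
          ≡⟨ cong (λ d → be M A w * d * stepMass w) (sym same-denominator) ⟩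
        be M A w * denA M A w * stepMass w
          ≡⟨ cong (_* stepMass w) (be-*-denA w (λ dw≡0 → D≢0 (trans (sym same-denominator) dw≡0))) ⟩
        PrA M A w * stepMass w ∎
        where
        same-denominator : denA M A w ≡ D
        same-denominator =
          denA-respects-obsEq w ρ (∧-conicalʳ (isPath M w) (obsEq M A w ρ) inClass)

    be-∷ʳ : 0ℚ < denA M A (ρ ∷ʳ t) → be M A (ρ ∷ʳ t) ≡ (be M A ρ * T A (last ρ) t) ÷ₜ normaliser
    be-∷ʳ 0<E = begin
      PrA M A (ρ ∷ʳ t) ÷ₜ denA M A (ρ ∷ʳ t)
        ≡⟨ cong₂ _÷ₜ_ (PrA-∷ʳ ρ t) (sym (normaliser-*-denA D≢0)) ⟩
      (PrA M A ρ * τ) ÷ₜ (normaliser * D)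
        ≡⟨ cong (λ p → (p * τ) ÷ₜ (normaliser * D)) (sym (be-*-denA ρ D≢0)) ⟩
      (be M A ρ * D * τ) ÷ₜ (normaliser * D)
        ≡⟨ cong (_÷ₜ (normaliser * D)) (*-Properties.xy∙z≈xz∙y (be M A ρ) D τ) ⟩
      (be M A ρ * τ * D) ÷ₜ (normaliser * D)
        ≡⟨ ÷ₜ-cancelʳ (be M A ρ * τ) normaliser D≢0 ⟩
      (be M A ρ * τ) ÷ₜ normaliser ∎
      where
      open ≡-Reasoning
      D τ : ℚ
      D = denA M A ρ
      τ = T A (last ρ) t
      D≢0 : D ≢ 0ℚ
      D≢0 = denA-≢0 0<E

  be-init-last : ∀ {k} (ρ : Vec (S M) (suc (suc k))) → 0ℚ < denA M A ρ →
                 be M A ρ ≡ (be M A (init ρ) * T A (last (init ρ)) (last ρ)) ÷ₜ normaliser (init ρ) (last ρ)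
  be-init-last ρ with initLast ρ
  ... | w , t , refl = be-∷ʳ w t

mainTheorem1 : (M : ASMAS) → (A : Fin (ASMAS.nAg M)) →
    ((s : Fin (ASMAS.nS M)) → 0ℚ < denA M A (s ∷ []) →
       be M A (s ∷ []) ≡
         ASMAS.μ₀ M s ÷ₜ ΣFin (ASMAS.nS M) (λ s' →
           if ASMAS.obs M A s' == ASMAS.obs M A s then ASMAS.μ₀ M s' else 0ℚ))
    ×
    ((k : ℕ) → (ρ : Vec (Fin (ASMAS.nS M)) (suc (suc k))) →
       isPath M ρ ≡ true → 0ℚ < denA M A ρ →
       be M A ρ ≡
         (be M A (init ρ) * ASMAS.T M A (last (init ρ)) (last ρ)) ÷ₜ
         ΣobsEq M A (init ρ) (λ ρ' →
           ΣFin (ASMAS.nS M) (λ s →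
             if ASMAS.obs M A s == ASMAS.obs M A (last ρ)
             then be M A ρ' * ASMAS.T M A (last ρ') s
             else 0ℚ)))
mainTheorem1 M A = (λ s _ → be-singleton M A s) , (λ k ρ _ → be-init-last M A ρ)
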